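{- For every $N\ge1$ and every sequence $(k_i)_{i=0}^{N-1}$ of integers $\ge1$ with $k_0>1$, there is $M\le N$ such that $(k_i)_{i=0}^{M-1}$ is non-periodic and there exists a non-edge-collapsing equivalence relation $\sim$ on $\mathbf{FC}_{(k_i)_{i=0}^{N-1}}$ with $\mathbf{FC}_{(k_i)_{i=0}^{N-1}}/\sim\ \cong\ \mathbf{FC}_{(k_i)_{i=0}^{M-1}}$.
   Context: Graphs are directed multigraphs $G=(VG,EG,o,t)$. Focal unfolding cycle: for $N\ge1$ and integers $k_0,\dots,k_{N-1}\ge1$ with $k_0>1$, $\mathbf{FC}_{(k_i)_{i=0}^{N-1}}$ has vertices $v_0,\dots,v_{N-1},w_0,\dots,w_{N-1},R$ and edges: $k_i$ edges from $v_i$ to $v_{i+1\bmod N}$; $k_i-1$ edges from $w_i$ to $v_{i+1\bmod N}$; one edge from $w_i$ to $w_{i-1\bmod N}$ (for each $0\le i<N$); $k_0$ edges from $R$ to $v_{1\bmod N}$; and one edge from $R$ to $w_{N-1}$. A sequence $(k_i)_{i=0}^{M-1}$ is periodic if there is $1\le m<M$ with $k_i=k_{i+m\bmod M}$ for all $i$; non-periodic otherwise. A graph equivalence relation is an equivalence relation on vertices and on edges compatible with $o,t$; the quotient $G/\sim$ has the classes as vertices and edges. It is non-edge-collapsing if for all vertices $v\sim w$ there are bijections $\pi_{v,w}:o^{ -1}(v)\to o^{ -1}(w)$ with $e\sim f\iff o(e)\sim o(f)$ and $\pi_{o(e),o(f)}(e)=f$. $\cong$ is isomorphism of directed graphs.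 -}

module Defs where

open import Level using (0ℓ)
open import Data.Nat using (ℕ; zero; suc; _+_; _∸_; _≤_; _<_; s≤s)
open import Data.Nat.DivMod using (_%_; m%n<n)
open import Data.Fin using (Fin; toℕ; fromℕ<; inject≤; fromℕ)
import Data.Fin as F
open import Data.Product using (Σ; ∃; ∃-syntax; _×_; _,_; proj₁)
open import Relation.Binary.Core using (Rel)
open import Relation.Binary.Structures using (IsEquivalence)
open import Relation.Binary.Bundles using (Setoid)
open import Relation.Binary.PropositionalEquality using (_≡_; refl)
import Relation.Binary.PropositionalEquality as ≡
open import Function.Bundles using (Inverse; _↔_; _⇔_)

record Graph : Set₁ where
  field
    V : Set
    E : Set
    o : E → V
    t : E → V
open Graph

Out : (G : Graph) → V G → Set
Out G x = Σ (E G) λ e → o G e ≡ x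

record GraphEquiv (G : Graph) : Set₁ where
  field
    _∼V_ : Rel (V G) 0ℓ
    _∼E_ : Rel (E G) 0ℓ
    isEquivV : IsEquivalence _∼V_
    isEquivE : IsEquivalence _∼E_
    o-compat : ∀ {e f} → e ∼E f → o G e ∼V o G f
    t-compat : ∀ {e f} → e ∼E f → t G e ∼V t G f

NonEdgeCollapsing : {G : Graph} → GraphEquiv G → Set
NonEdgeCollapsing {G} R =
  Σ ((x y : V G) → x ∼V y → Out G x ↔ Out G y) λ π →
    ∀ (e f : E G) →
      e ∼E f ⇔ (Σ (o G e ∼V o G f) λ p →
                  proj₁ (Inverse.to (π (o G e) (o G f) p) (e , refl)) ≡ f)
  where open GraphEquiv R

-- Quotient G/∼, represented (no quotient types) as a "setoid graph":
-- vertex/edge carriers of G with equality ∼.  A plain graph is a setoid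
-- graph with propositional equality.

record SetoidGraph : Set₁ where
  field
    VS : Setoid 0ℓ 0ℓ
    ES : Setoid 0ℓ 0ℓ
    so : Setoid.Carrier ES → Setoid.Carrier VS
    st : Setoid.Carrier ES → Setoid.Carrier VS
    so-cong : ∀ {e f} → Setoid._≈_ ES e f → Setoid._≈_ VS (so e) (so f)
    st-cong : ∀ {e f} → Setoid._≈_ ES e f → Setoid._≈_ VS (st e) (st f)

toSetoidGraph : Graph → SetoidGraph
toSetoidGraph G = record
  { VS = ≡.setoid (V G) ; ES = ≡.setoid (E G) ; so = o G ; st = t G
  ; so-cong = ≡.cong (o G) ; st-cong = ≡.cong (t G) }

Quotient : (G : Graph) → GraphEquiv G → SetoidGraph
Quotient G R = record
  { VS = record { Carrier = V G ; _≈_ = _∼V_ ; isEquivalence = isEquivV }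
  ; ES = record { Carrier = E G ; _≈_ = _∼E_ ; isEquivalence = isEquivE }
  ; so = o G ; st = t G ; so-cong = o-compat ; st-cong = t-compat }
  where open GraphEquiv R

record _≅_ (A B : SetoidGraph) : Set where
  open SetoidGraph
  field
    isoV : Inverse (VS A) (VS B)
    isoE : Inverse (ES A) (ES B)
    o-comm : ∀ e → Setoid._≈_ (VS B) (so B (Inverse.to isoE e)) (Inverse.to isoV (so A e))
    t-comm : ∀ e → Setoid._≈_ (VS B) (st B (Inverse.to isoE e)) (Inverse.to isoV (st A e))

-- Sequences (k_i)_{i=0}^{N-1} with N = suc n, indices mod N

next : ∀ {n} → Fin (suc n) → Fin (suc n)
next {n} i = fromℕ< (m%n<n (suc (toℕ i)) (suc n))

prev : ∀ {n} → Fin (suc n) → Fin (suc n)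
prev {n} i = fromℕ< (m%n<n (toℕ i + n) (suc n))

one : ∀ {n} → Fin (suc n)
one {n} = fromℕ< (m%n<n 1 (suc n))

Periodic : ∀ {n} → (Fin (suc n) → ℕ) → Set
Periodic {n} k = ∃[ m ] (1 ≤ m × m < suc n ×
  (∀ (i : Fin (suc n)) → k i ≡ k (fromℕ< (m%n<n (toℕ i + m) (suc n)))))

restrict : ∀ {m n} → m ≤ n → (Fin (suc n) → ℕ) → (Fin (suc m) → ℕ)
restrict m≤n k i = k (inject≤ i (s≤s m≤n))

data FCV (n : ℕ) : Set where
  v : Fin (suc n) → FCV n
  w : Fin (suc n) → FCV n
  R : FCV n

data FCE (n : ℕ) (k : Fin (suc n) → ℕ) : Set where
  vv : (i : Fin (suc n)) → Fin (k i) → FCE n k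
  wv : (i : Fin (suc n)) → Fin (k i ∸ 1) → FCE n k
  ww : (i : Fin (suc n)) → FCE n k
  Rv : Fin (k F.zero) → FCE n k
  Rw : FCE n k

FC : (n : ℕ) → (Fin (suc n) → ℕ) → Graph
FC n k = record { V = FCV n ; E = FCE n k ; o = src ; t = tgt }
  where
  src : FCE n k → FCV n
  src (vv i _) = v i
  src (wv i _) = w i
  src (ww i)   = w i
  src (Rv _)   = R
  src Rw       = R
  tgt : FCE n k → FCV n
  tgt (vv i _) = v (next i)
  tgt (wv i _) = v (next i)
  tgt (ww i)   = w (prev i)
  tgt (Rv _)   = v one
  tgt Rw       = w (fromℕ n)

-- Let d be the least period of the cyclic sequence i ↦ k (i mod N).  The
-- least period divides every period, so d ∣ N, and the first d terms form a
-- non-periodic sequence k′ whose cyclic extension is that of k.  Reducing all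
-- indices mod d then maps FC_k onto FC_k′ and, because k is d-periodic, maps
-- the out-edges of every vertex bijectively onto those of its image.  The
-- kernel of such a surjective opfibration is a non-edge-collapsing
-- equivalence, and the quotient by it is isomorphic to the target.
module Submission where

open import Defs
open import Data.Nat using (ℕ; zero; suc; s≤s; _+_; _*_; _∸_; _≤_; _<_; NonZero; _≟_)
open import Data.Nat.Properties
  using (+-identityʳ; +-assoc; +-comm; ≤-pred)
open import Data.Nat.DivMod
open import Data.Nat.Divisibility using (_∣_; m%n≡0⇒n∣m; n∣m⇒m%n≡0)
open import Data.Fin using (Fin; zero; toℕ; fromℕ<; inject≤; fromℕ; cast)
open import Data.Fin.Properties
  using ( toℕ-injective; toℕ-fromℕ<; toℕ-fromℕ; toℕ-inject≤; toℕ-inject; toℕ<n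
        ; fromℕ<-cong; fromℕ<-toℕ; cast-involutive; all?; ¬∀⟶∃¬-smallest)
open import Data.Product using (Σ; ∃; ∃-syntax; _×_; _,_; proj₁; proj₂)
open import Data.Empty using (⊥-elim)
open import Function.Base using (_∘_; _on_)
open import Function.Bundles using (_↔_; mk⇔; mk↔ₛ′)
open import Relation.Nullary using (¬_; Dec; ¬?)
open import Relation.Nullary.Decidable using (map′; decidable-stable)
open import Relation.Binary.PropositionalEquality
import Relation.Binary.Construct.On as On

open Graph

private
  variable
    A : Set
    m n : ℕ

[m+n%d]%d≡[m+n]%d : ∀ a b d .{{_ : NonZero d}} → (a + b % d) % d ≡ (a + b) % d
[m+n%d]%d≡[m+n]%d a b d = begin
  (a + b % d) % d           ≡⟨ %-distribˡ-+ a (b % d) d ⟩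
  (a % d + b % d % d) % d   ≡⟨ cong (λ r → (a % d + r) % d) (m%n%n≡m%n b d) ⟩
  (a % d + b % d) % d       ≡⟨ %-distribˡ-+ a b d ⟨
  (a + b) % d               ∎
  where open ≡-Reasoning

mod-cong : ∀ a b d .{{_ : NonZero d}} → a % d ≡ b % d → a mod d ≡ b mod d
mod-cong a b d eq = fromℕ<-cong (a % d) (b % d) eq (m%n<n a d) (m%n<n b d)

mod-toℕ : (i : Fin (suc n)) → toℕ i mod suc n ≡ i
mod-toℕ {n} i = trans (fromℕ<-cong _ _ (m<n⇒m%n≡m (toℕ<n i)) (m%n<n (toℕ i) (suc n)) (toℕ<n i))
                      (fromℕ<-toℕ i (toℕ<n i))

Period : (ℕ → A) → ℕ → Set
Period f s = ∀ a → f a ≡ f (a + s)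

module _ {f : ℕ → A} where

  period-* : ∀ {s} → Period f s → ∀ q → Period f (q * s)
  period-* p zero    a = cong f (sym (+-identityʳ a))
  period-* {s} p (suc q) a =
    trans (p a) (trans (period-* p q (a + s)) (cong f (+-assoc a s (q * s))))

  period-+-cancelˡ : ∀ {s t} → Period f s → Period f (s + t) → Period f t
  period-+-cancelˡ {s} {t} ps pst a = begin
    f a             ≡⟨ pst a ⟩
    f (a + (s + t)) ≡⟨ cong f (trans (cong (a +_) (+-comm s t)) (sym (+-assoc a t s))) ⟩
    f (a + t + s)   ≡⟨ ps (a + t) ⟨
    f (a + t)       ∎
    where open ≡-Reasoning

  period-% : ∀ {d} .{{_ : NonZero d}} → Period f d → ∀ a → f a ≡ f (a % d)
  period-% {d} p a =
    trans (cong f (m≡m%n+[m/n]*n a d)) (sym (period-* p (a / d) (a % d)))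

  -- The remainder of p by the least period is itself a period.
  leastPeriod-∣ : Period f (suc m) → (∀ t → t < m → ¬ Period f (suc t)) →
                  ∀ {p} → Period f p → suc m ∣ p
  leastPeriod-∣ {m} pd minimal {p} pp with p % suc m in eq
  ... | zero  = m%n≡0⇒n∣m p (suc m) eq
  ... | suc r = ⊥-elim (minimal r r<m
                  (period-+-cancelˡ (period-* pd (p / suc m)) (subst (Period f) p≡ pp)))
    where
    r<m : r < m
    r<m = ≤-pred (subst (_< suc m) eq (m%n<n p (suc m)))
    p≡ : p ≡ p / suc m * suc m + suc r
    p≡ = trans (m≡m%n+[m/n]*n p (suc m))
               (trans (cong (_+ p / suc m * suc m) eq) (+-comm (suc r) _))

  leastPeriod : Period f (suc n) → (∀ s → Dec (Period f s)) →
                ∃[ m ] m ≤ n × Period f (suc m) × (∀ t → t < m → ¬ Period f (suc t))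
  leastPeriod {n} pN period? with
    ¬∀⟶∃¬-smallest (suc n) (λ i → ¬ Period f (suc (toℕ i))) (λ i → ¬? (period? _))
      (λ aperiodic → aperiodic (fromℕ n) (subst (Period f ∘ suc) (sym (toℕ-fromℕ n)) pN))
  ... | i , ¬¬period , below =
    toℕ i , ≤-pred (toℕ<n i) , decidable-stable (period? _) ¬¬period , minimal
    where
    minimal : ∀ t → t < toℕ i → ¬ Period f (suc t)
    minimal t t<i = subst (λ u → ¬ Period f (suc u))
      (trans (toℕ-inject (fromℕ< t<i)) (toℕ-fromℕ< t<i)) (below (fromℕ< t<i))

period-resp-≗ : ∀ {f g : ℕ → A} {s} → f ≗ g → Period f s → Period g s
period-resp-≗ {s = s} f≗g p a = trans (sym (f≗g a)) (trans (p a) (f≗g (a + s)))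

cyclic : (Fin (suc n) → A) → ℕ → A
cyclic {n} k a = k (a mod suc n)

module _ (k : Fin (suc n) → A) where

  cyclic-toℕ : ∀ i → cyclic k (toℕ i) ≡ k i
  cyclic-toℕ i = cong k (mod-toℕ i)

  cyclic-cong : ∀ a b → a % suc n ≡ b % suc n → cyclic k a ≡ cyclic k b
  cyclic-cong a b eq = cong k (mod-cong a b (suc n) eq)

  period-cyclic : Period (cyclic k) (suc n)
  period-cyclic a = cyclic-cong a (a + suc n) (sym ([m+n]%n≡m%n a (suc n)))

  period-fromResidues : ∀ {s} → (∀ i → cyclic k (toℕ i) ≡ cyclic k (toℕ i + s)) →
                        Period (cyclic k) s
  period-fromResidues {s} p a = begin
    cyclic k a           ≡⟨ cyclic-cong a (toℕ i) (sym (trans (cong (_% suc n) toℕ-i) (m%n%n≡m%n a _))) ⟩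
    cyclic k (toℕ i)     ≡⟨ p i ⟩
    cyclic k (toℕ i + s) ≡⟨ cyclic-cong (toℕ i + s) (a + s) i+s≡a+s ⟩
    cyclic k (a + s)     ∎
    where
    open ≡-Reasoning
    i : Fin (suc n)
    i = a mod suc n
    toℕ-i : toℕ i ≡ a % suc n
    toℕ-i = toℕ-fromℕ< (m%n<n a (suc n))
    i+s≡a+s : (toℕ i + s) % suc n ≡ (a + s) % suc n
    i+s≡a+s = begin
      (toℕ i + s) % suc n     ≡⟨ cong (_% suc n) (+-comm (toℕ i) s) ⟩
      (s + toℕ i) % suc n     ≡⟨ cong (λ r → (s + r) % suc n) toℕ-i ⟩
      (s + a % suc n) % suc n ≡⟨ [m+n%d]%d≡[m+n]%d s a (suc n) ⟩
      (s + a) % suc n         ≡⟨ cong (_% suc n) (+-comm s a) ⟩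
      (a + s) % suc n         ∎

cyclic-restrict : ∀ {k : Fin (suc n) → ℕ} (m≤n : m ≤ n) → Period (cyclic k) (suc m) →
                  cyclic (restrict m≤n k) ≗ cyclic k
cyclic-restrict {m = m} {k = k} m≤n p a = begin
  k i                  ≡⟨ cyclic-toℕ k i ⟨
  cyclic k (toℕ i)     ≡⟨ cong (cyclic k) toℕ-i ⟩
  cyclic k (a % suc m) ≡⟨ period-% p a ⟨
  cyclic k a           ∎
  where
  open ≡-Reasoning
  i : Fin (suc _)
  i = inject≤ (a mod suc m) (s≤s m≤n)
  toℕ-i : toℕ i ≡ a % suc m
  toℕ-i = trans (toℕ-inject≤ (a mod suc m) (s≤s m≤n)) (toℕ-fromℕ< (m%n<n a (suc m)))

period? : (k : Fin (suc n) → ℕ) → ∀ s → Dec (Period (cyclic k) s)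
period? k s = map′ (period-fromResidues k) (λ p i → p (toℕ i))
                   (all? λ i → cyclic k (toℕ i) ≟ cyclic k (toℕ i + s))

Periodic⇒period : (k : Fin (suc n) → ℕ) → Periodic k →
                  ∃[ s ] 1 ≤ s × s < suc n × Period (cyclic k) s
Periodic⇒period k (s , 1≤s , s<N , shift) =
  s , 1≤s , s<N , period-fromResidues k (λ i → trans (cyclic-toℕ k i) (shift i))

reduce : Fin (suc n) → Fin (suc m)
reduce {m = m} i = toℕ i mod suc m

toℕ-reduce : (i : Fin (suc n)) → toℕ (reduce {n} {m} i) ≡ toℕ i % suc m
toℕ-reduce {m = m} i = toℕ-fromℕ< (m%n<n (toℕ i) (suc m))

reduce-inject≤ : (m≤n : m ≤ n) (a : Fin (suc m)) → reduce {n} {m} (inject≤ a (s≤s m≤n)) ≡ a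
reduce-inject≤ {m} m≤n a = trans
  (mod-cong (toℕ (inject≤ a (s≤s m≤n))) (toℕ a) (suc m) (cong (_% suc m) (toℕ-inject≤ a (s≤s m≤n))))
  (mod-toℕ a)

module _ (d∣N : suc m ∣ suc n) where

  n%d≡m : n % suc m ≡ m
  n%d≡m = %-pred-≡0 (n∣m⇒m%n≡0 (suc n) (suc m) d∣N)

  reduce-mod : ∀ a → reduce {n} {m} (a mod suc n) ≡ a mod suc m
  reduce-mod a = mod-cong (toℕ (a mod suc n)) a (suc m) (begin
    toℕ (a mod suc n) % suc m ≡⟨ cong (_% suc m) (toℕ-fromℕ< (m%n<n a (suc n))) ⟩
    a % suc n % suc m         ≡⟨ m∣n⇒o%n%m≡o%m (suc m) (suc n) a d∣N ⟩
    a % suc m                 ∎)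
    where open ≡-Reasoning

  reduce-next : ∀ i → reduce (next i) ≡ next (reduce {n} {m} i)
  reduce-next i = trans (reduce-mod (1 + toℕ i))
    (mod-cong (1 + toℕ i) (1 + toℕ (reduce {n} {m} i)) (suc m) (sym (begin
      (1 + toℕ (reduce i)) % suc m  ≡⟨ cong (λ r → (1 + r) % suc m) (toℕ-reduce i) ⟩
      (1 + toℕ i % suc m) % suc m   ≡⟨ [m+n%d]%d≡[m+n]%d 1 (toℕ i) (suc m) ⟩
      (1 + toℕ i) % suc m           ∎)))
    where open ≡-Reasoning

  reduce-prev : ∀ i → reduce (prev i) ≡ prev (reduce {n} {m} i)
  reduce-prev i = trans (reduce-mod (toℕ i + n))
    (mod-cong (toℕ i + n) (toℕ (reduce {n} {m} i) + m) (suc m) (begin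
      (toℕ i + n) % suc m                 ≡⟨ %-distribˡ-+ (toℕ i) n (suc m) ⟩
      (toℕ i % suc m + n % suc m) % suc m ≡⟨ cong₂ (λ a b → (a + b) % suc m) (sym (toℕ-reduce i)) n%d≡m ⟩
      (toℕ (reduce i) + m) % suc m        ∎))
    where open ≡-Reasoning

  reduce-one : reduce {n} {m} one ≡ one
  reduce-one = reduce-mod 1

  reduce-fromℕ : reduce {n} {m} (fromℕ n) ≡ fromℕ m
  reduce-fromℕ = toℕ-injective (begin
    toℕ (reduce (fromℕ n)) ≡⟨ toℕ-reduce (fromℕ n) ⟩
    toℕ (fromℕ n) % suc m  ≡⟨ cong (_% suc m) (toℕ-fromℕ n) ⟩
    n % suc m              ≡⟨ n%d≡m ⟩
    m                      ≡⟨ toℕ-fromℕ m ⟨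
    toℕ (fromℕ m)          ∎)
    where open ≡-Reasoning

module _ (k : Fin (suc n) → ℕ) (m≤n : m ≤ n) (period : Period (cyclic k) (suc m)) where

  restrict-reduce : ∀ i → k i ≡ restrict m≤n k (reduce i)
  restrict-reduce i =
    trans (sym (cyclic-toℕ k i)) (sym (cyclic-restrict {k = k} m≤n period (toℕ i)))

  restrict-nonPeriodic : (∀ t → t < m → ¬ Period (cyclic k) (suc t)) →
                         ¬ Periodic (restrict m≤n k)
  restrict-nonPeriodic minimal periodic with Periodic⇒period (restrict m≤n k) periodic
  ... | suc t , _ , t<d , p =
    minimal t (≤-pred t<d) (period-resp-≗ (cyclic-restrict {k = k} m≤n period) p)

-- Surjective opfibrations and their kernels

record SurjectiveOpfibration (G H : Graph) : Set where
  field
    vertex : V G → V H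
    edge   : E G → E H
    o-edge : ∀ e → o H (edge e) ≡ vertex (o G e)
    t-edge : ∀ e → t H (edge e) ≡ vertex (t G e)
    vertex-surjective : ∀ y → ∃ λ x → vertex x ≡ y
    lift : ∀ x e′ → o H e′ ≡ vertex x → ∃ λ e → o G e ≡ x × edge e ≡ e′
    lift-unique : ∀ e {x e′} → o G e ≡ x → edge e ≡ e′ →
                  (p : o H e′ ≡ vertex x) → proj₁ (lift x e′ p) ≡ e

module _ {G H : Graph} (φ : SurjectiveOpfibration G H) where
  open SurjectiveOpfibration φ

  kernel : GraphEquiv G
  kernel = record
    { _∼V_ = _≡_ on vertex
    ; _∼E_ = _≡_ on edge
    ; isEquivV = On.isEquivalence vertex isEquivalence
    ; isEquivE = On.isEquivalence edge isEquivalence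
    ; o-compat = λ {e} {f} eq → trans (sym (o-edge e)) (trans (cong (o H) eq) (o-edge f))
    ; t-compat = λ {e} {f} eq → trans (sym (t-edge e)) (trans (cong (t H) eq) (t-edge f))
    }

  private
    -- By K, an element of Out G x is determined by its edge.
    Out-≡ : ∀ {x} {u u′ : Out G x} → proj₁ u ≡ proj₁ u′ → u ≡ u′
    Out-≡ {u = _ , refl} {u′ = _ , refl} refl = refl

    transportLift : ∀ {x y} → vertex x ≡ vertex y → (u : Out G x) →
                    ∃ λ e → o G e ≡ y × edge e ≡ edge (proj₁ u)
    transportLift {y = y} p (e , q) = lift y (edge e) (trans (o-edge e) (trans (cong vertex q) p))

    transport : ∀ {x y} → vertex x ≡ vertex y → Out G x → Out G y
    transport p u = let e , q , _ = transportLift p u in e , q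

    transport-inverse : ∀ {x y} (p : vertex x ≡ vertex y) (q : vertex y ≡ vertex x) u →
                        transport q (transport p u) ≡ u
    transport-inverse p q u@(e , o≡) =
      Out-≡ (lift-unique e o≡ (sym (proj₂ (proj₂ (transportLift p u)))) _)

  kernel-nonEdgeCollapsing : NonEdgeCollapsing kernel
  kernel-nonEdgeCollapsing = π , λ e f → mk⇔
    (λ eq → GraphEquiv.o-compat kernel eq , lift-unique f refl (sym eq) _)
    (λ (_ , lifted) → trans (sym (proj₂ (proj₂ (lift (o G f) (edge e) _)))) (cong edge lifted))
    where
    π : ∀ x y → vertex x ≡ vertex y → Out G x ↔ Out G y
    π x y p = mk↔ₛ′ (transport p) (transport (sym p))
                    (transport-inverse (sym p) p) (transport-inverse p (sym p))

  quotient-kernel≅ : Quotient G kernel ≅ toSetoidGraph H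
  quotient-kernel≅ = record
    { isoV = record
      { to = vertex
      ; from = section
      ; to-cong = λ eq → eq
      ; from-cong = λ {a} {b} eq → trans (section-vertex a) (trans eq (sym (section-vertex b)))
      ; inverse = (λ {a} eq → trans eq (section-vertex a))
                , (λ {_} {b} eq → trans (section-vertex b) eq)
      }
    ; isoE = record
      { to = edge
      ; from = edgeSection
      ; to-cong = λ eq → eq
      ; from-cong = λ {a} {b} eq →
          trans (edge-edgeSection a) (trans eq (sym (edge-edgeSection b)))
      ; inverse = (λ {a} eq → trans eq (edge-edgeSection a))
                , (λ {_} {b} eq → trans (edge-edgeSection b) eq)
      }
    ; o-comm = o-edge
    ; t-comm = t-edge
    }
    where
    section : V H → V G
    section y = proj₁ (vertex-surjective y)

    section-vertex : ∀ y → vertex (section y) ≡ y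
    section-vertex y = proj₂ (vertex-surjective y)

    edgeLift : ∀ e′ → ∃ λ e → o G e ≡ section (o H e′) × edge e ≡ e′
    edgeLift e′ = lift (section (o H e′)) e′ (sym (section-vertex (o H e′)))

    edgeSection : E H → E G
    edgeSection e′ = proj₁ (edgeLift e′)

    edge-edgeSection : ∀ e′ → edge (edgeSection e′) ≡ e′
    edge-edgeSection e′ = proj₂ (proj₂ (edgeLift e′))

-- Folding a focal unfolding cycle onto a divisor of its length

module _ {m n} (m≤n : m ≤ n) (d∣N : suc m ∣ suc n) (k : Fin (suc n) → ℕ)
         (k-reduce : ∀ i → k i ≡ restrict m≤n k (reduce i)) where

  private
    k′ : Fin (suc m) → ℕ
    k′ = restrict m≤n k

    G H : Graph
    G = FC n k
    H = FC m k′

    reduceV : FCV n → FCV m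
    reduceV (v i) = v (reduce i)
    reduceV (w i) = w (reduce i)
    reduceV R     = R

    injectV : FCV m → FCV n
    injectV (v a) = v (inject≤ a (s≤s m≤n))
    injectV (w a) = w (inject≤ a (s≤s m≤n))
    injectV R     = R

    reduceV-injectV : ∀ y → reduceV (injectV y) ≡ y
    reduceV-injectV (v a) = cong v (reduce-inject≤ m≤n a)
    reduceV-injectV (w a) = cong w (reduce-inject≤ m≤n a)
    reduceV-injectV R     = refl

    -- k′ zero is k zero by computation, so the edges out of R need no cast.
    reduceE : FCE n k → FCE m k′
    reduceE (vv i j) = vv (reduce i) (cast (k-reduce i) j)
    reduceE (wv i j) = wv (reduce i) (cast (cong (_∸ 1) (k-reduce i)) j)
    reduceE (ww i)   = ww (reduce i)
    reduceE (Rv j)   = Rv j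
    reduceE Rw       = Rw

    o-reduceE : ∀ e → o H (reduceE e) ≡ reduceV (o G e)
    o-reduceE (vv i j) = refl
    o-reduceE (wv i j) = refl
    o-reduceE (ww i)   = refl
    o-reduceE (Rv j)   = refl
    o-reduceE Rw       = refl

    t-reduceE : ∀ e → t H (reduceE e) ≡ reduceV (t G e)
    t-reduceE (vv i j) = cong v (sym (reduce-next d∣N i))
    t-reduceE (wv i j) = cong v (sym (reduce-next d∣N i))
    t-reduceE (ww i)   = cong w (sym (reduce-prev d∣N i))
    t-reduceE (Rv j)   = cong v (sym (reduce-one d∣N))
    t-reduceE Rw       = cong w (sym (reduce-fromℕ d∣N))

    lift : ∀ x e′ → o H e′ ≡ reduceV x → ∃ λ e → o G e ≡ x × reduceE e ≡ e′
    lift (v i) (vv _ j) refl =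
      vv i (cast (sym (k-reduce i)) j) , refl ,
      cong (vv (reduce i)) (cast-involutive (k-reduce i) (sym (k-reduce i)) j)
    lift (w i) (wv _ j) refl =
      wv i (cast (cong (_∸ 1) (sym (k-reduce i))) j) , refl ,
      cong (wv (reduce i)) (cast-involutive (cong (_∸ 1) (k-reduce i)) (cong (_∸ 1) (sym (k-reduce i))) j)
    lift (w i) (ww _)   refl = ww i , refl , refl
    lift R     (Rv j)   refl = Rv j , refl , refl
    lift R     Rw       refl = Rw , refl , refl
    lift (v _) (wv _ _) ()
    lift (v _) (ww _)   ()
    lift (v _) (Rv _)   ()
    lift (v _) Rw       ()
    lift (w _) (vv _ _) ()
    lift (w _) (Rv _)   ()
    lift (w _) Rw       ()
    lift R     (vv _ _) ()
    lift R     (wv _ _) ()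
    lift R     (ww _)   ()

    lift-unique : ∀ e {x e′} → o G e ≡ x → reduceE e ≡ e′ →
                  (p : o H e′ ≡ reduceV x) → proj₁ (lift x e′ p) ≡ e
    lift-unique (vv i j) refl refl refl =
      cong (vv i) (cast-involutive (sym (k-reduce i)) (k-reduce i) j)
    lift-unique (wv i j) refl refl refl =
      cong (wv i) (cast-involutive (cong (_∸ 1) (sym (k-reduce i))) (cong (_∸ 1) (k-reduce i)) j)
    lift-unique (ww i)   refl refl refl = refl
    lift-unique (Rv j)   refl refl refl = refl
    lift-unique Rw       refl refl refl = refl

  FC-reduceOpfibration : SurjectiveOpfibration G H
  FC-reduceOpfibration = record
    { vertex = reduceV
    ; edge = reduceE
    ; o-edge = o-reduceE
    ; t-edge = t-reduceE
    ; vertex-surjective = λ y → injectV y , reduceV-injectV y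
    ; lift = lift
    ; lift-unique = lift-unique
    }

lemma17 : (n : ℕ) (k : Fin (suc n) → ℕ) → (∀ i → 1 ≤ k i) → 1 < k zero →
    ∃[ m ] Σ (m ≤ n) λ m≤n →
      ¬ Periodic (restrict m≤n k) ×
      ∃[ ∼ ] (NonEdgeCollapsing {FC n k} ∼ ×
              Quotient (FC n k) ∼ ≅ toSetoidGraph (FC m (restrict m≤n k)))
lemma17 n k _ _ =
  let m , m≤n , period , minimal = leastPeriod {f = cyclic k} (period-cyclic k) (period? k)
      φ = FC-reduceOpfibration m≤n (leastPeriod-∣ period minimal (period-cyclic k)) k
                               (restrict-reduce k m≤n period)
  in m , m≤n , restrict-nonPeriodic k m≤n period minimal ,
     kernel φ , kernel-nonEdgeCollapsing φ , quotient-kernel≅ φ
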